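{- For every $n\ge1$ there exist bijections $\phi_n:\operatorname{IPPM}_n^-\to\operatorname{IPPM}_{n+1}^+$ and $\psi_n:\mathbf{I}_n^-(-,-,=)\to\mathbf{I}_{n+1}^+(-,-,=)$ such that $v(\phi_n(Q))=v(Q)$ for every $Q\in\operatorname{IPPM}_n^-$ and $\operatorname{dist}(\psi_n(e))=\operatorname{dist}(e)$ for every $e\in\mathbf{I}_n^-(-,-,=)$.
   Context: For $n\ge1$ let $[n]=\{1,\ldots,n\}$. A partition matrix on $[n]$ is an upper-triangular square matrix whose entries are subsets of $[n]$ (entries below the diagonal are empty) such that: each row and each column contains at least one nonempty entry; the nonempty entries form a set partition of $[n]$; and for all $i,j\in[n]$, if $\operatorname{col}(i)<\operatorname{col}(j)$ then $i<j$, where $\operatorname{col}(k)$ (resp. $\operatorname{row}(k)$) is the column (resp. row) index of the entry containing $k$. For $1<i<n$, $i$ is a descent (resp. ascent) if $\operatorname{col}(i)=\operatorname{col}(i+1)$ and $\operatorname{row}(i)>\operatorname{row}(i+1)$ (resp. $<$); it is proper if $i\equiv j\pmod2$ with $j$ the minimal element of column $\operatorname{col}(i)$, improper otherwise. $\operatorname{IPPM}_n$ is the set of partition matrices on $[n]$ all of whose descents and ascents are improper. $\operatorname{IPPM}_n^+$ (resp. $\operatorname{IPPM}_n^-$) is the set of $Q\in\operatorname{IPPM}_n$ in which $n$ belongs to an entry of even (resp. odd) cardinality. The semi-weight of a partition matrix of dimension $D$ (number of rows) is $v(P)=\sum_{d=1}^D\lceil n_d/2\rceil$, with $n_d$ the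 number of elements in column $d$. An inversion sequence of length $n$ is $(e_1,\ldots,e_n)$ with $0\le e_i<i$; $\mathbf{I}_n(-,-,=)$ is the set of those with no indices $i<j<k$ such that $e_i=e_k$; $\mathbf{I}_n^+(-,-,=)$ (resp. $\mathbf{I}_n^-(-,-,=)$) is the set of $e\in\mathbf{I}_n(-,-,=)$ with $e_{n-1}=e_n$ (resp. $e_{n-1}\ne e_n$). $\operatorname{dist}(e)$ is the number of distinct values among the entries of $e$ (including $0$). -}

module Defs where

open import Data.Nat using (ℕ; zero; suc; _+_; _≤_; _<_; _%_; ⌈_/2⌉)
open import Data.Nat.Properties using (_≟_)
open import Data.Fin using (Fin; toℕ)
import Data.Fin as F
open import Data.Fin.Subset using (Subset; _∈_; ∣_∣; ⊥; Nonempty)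
open import Data.Vec using (Vec; lookup; tabulate; sum; map; toList)
open import Data.List using (length; deduplicate)
open import Data.Product using (Σ; ∃; ∃-syntax; _×_)
open import Data.Sum using (_⊎_)
open import Relation.Nullary using (¬_)
open import Relation.Binary.PropositionalEquality using (_≡_; _≢_)

-- Conventions: the ground set [n] = {1,…,n} is represented by Fin n,
-- the element k : Fin n standing for the integer  elt k = toℕ k + 1.
-- Rows and columns of a D×D matrix are indexed by Fin D (0-based),
-- which preserves all order comparisons.

elt : ∀ {n} → Fin n → ℕ
elt k = suc (toℕ k)

Matrix : ℕ → ℕ → Set
Matrix n D = Vec (Vec (Subset n) D) D

entry : ∀ {n D} → Matrix n D → Fin D → Fin D → Subset n
entry M r c = lookup (lookup M r) c

record IsPartitionMatrix {n D : ℕ} (M : Matrix n D) : Set where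
  field
    upper       : ∀ r c → c F.< r → entry M r c ≡ ⊥
    rowNonempty : ∀ r → ∃[ c ] Nonempty (entry M r c)
    colNonempty : ∀ c → ∃[ r ] Nonempty (entry M r c)
    covers      : ∀ k → ∃[ r ] ∃[ c ] k ∈ entry M r c
    disjoint    : ∀ k r c r′ c′ → k ∈ entry M r c → k ∈ entry M r′ c′ →
                  (r ≡ r′) × (c ≡ c′)
    colOrder    : ∀ i j ri ci rj cj → i ∈ entry M ri ci → j ∈ entry M rj cj →
                  ci F.< cj → elt i < elt j

record PartitionMatrix (n : ℕ) : Set where
  constructor pm
  field
    dim    : ℕ
    matrix : Matrix n dim
    .isPM  : IsPartitionMatrix matrix

open PartitionMatrix public

InColumn : ∀ {n D} → Matrix n D → Fin D → Fin n → Set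
InColumn M c k = ∃[ r ] k ∈ entry M r c

ColumnMin : ∀ {n D} → Matrix n D → Fin D → Fin n → Set
ColumnMin M c m = InColumn M c m × (∀ k → InColumn M c k → elt m ≤ elt k)

IsDescent : ∀ {n D} → Matrix n D → Fin n → Set
IsDescent {n} M i = (1 < elt i) × (elt i < n) ×
  (∃[ j ] (elt j ≡ suc (elt i)) ×
    (∃[ c ] ∃[ r ] ∃[ r′ ] (i ∈ entry M r c) × (j ∈ entry M r′ c) × (r′ F.< r)))

IsAscent : ∀ {n D} → Matrix n D → Fin n → Set
IsAscent {n} M i = (1 < elt i) × (elt i < n) ×
  (∃[ j ] (elt j ≡ suc (elt i)) ×
    (∃[ c ] ∃[ r ] ∃[ r′ ] (i ∈ entry M r c) × (j ∈ entry M r′ c) × (r F.< r′)))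

IsProper : ∀ {n D} → Matrix n D → Fin n → Set
IsProper M i = ∃[ c ] ∃[ m ] InColumn M c i × ColumnMin M c m ×
  (elt i % 2 ≡ elt m % 2)

AllImproper : ∀ {n D} → Matrix n D → Set
AllImproper M = ∀ i → (IsDescent M i ⊎ IsAscent M i) → ¬ IsProper M i

LastInEven : ∀ {n D} → Matrix n D → Set
LastInEven {n} M = ∃[ k ] ∃[ r ] ∃[ c ] (elt k ≡ n) × (k ∈ entry M r c) ×
  (∣ entry M r c ∣ % 2 ≡ 0)

LastInOdd : ∀ {n D} → Matrix n D → Set
LastInOdd {n} M = ∃[ k ] ∃[ r ] ∃[ c ] (elt k ≡ n) × (k ∈ entry M r c) ×
  (∣ entry M r c ∣ % 2 ≡ 1)

-- IPPM⁺_n and IPPM⁻_n (proof fields irrelevant, so equality is equality of matrices)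
record IPPM⁺ (n : ℕ) : Set where
  constructor ippm⁺
  field
    pmat      : PartitionMatrix n
    .improper : AllImproper (matrix pmat)
    .lastEven : LastInEven (matrix pmat)

record IPPM⁻ (n : ℕ) : Set where
  constructor ippm⁻
  field
    pmat      : PartitionMatrix n
    .improper : AllImproper (matrix pmat)
    .lastOdd  : LastInOdd (matrix pmat)

colSize : ∀ {n D} → Matrix n D → Fin D → ℕ
colSize M c = sum (map (λ row → ∣ lookup row c ∣) M)

v : ∀ {n} → PartitionMatrix n → ℕ
v P = sum (tabulate (λ c → ⌈ colSize (matrix P) c /2⌉))

-- Inversion sequences: e = (e_1,…,e_n), entry e_{k} stored at index k-1.
IsInversionSeq : ∀ {n} → Vec ℕ n → Set
IsInversionSeq e = ∀ k → lookup e k < elt k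

Avoids--= : ∀ {n} → Vec ℕ n → Set
Avoids--= {n} e = ∀ (i j k : Fin n) → i F.< j → j F.< k → lookup e i ≢ lookup e k

LastTwoEqual : ∀ {n} → Vec ℕ n → Set
LastTwoEqual {n} e = ∃[ i ] ∃[ j ] (elt i ≡ toℕ j) × (elt j ≡ n) × (lookup e i ≡ lookup e j)

record InvSeq⁺ (n : ℕ) : Set where
  constructor inv⁺
  field
    seq      : Vec ℕ n
    .isInv   : IsInversionSeq seq
    .avoids  : Avoids--= seq
    .lastEq  : LastTwoEqual seq

record InvSeq⁻ (n : ℕ) : Set where
  constructor inv⁻
  field
    seq      : Vec ℕ n
    .isInv   : IsInversionSeq seq
    .avoids  : Avoids--= seq
    .lastNeq : ¬ LastTwoEqual seq

dist : ∀ {n} → Vec ℕ n → ℕ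
dist e = length (deduplicate _≟_ (toList e))

-- Both bijections append a copy of the last datum, and their inverses delete it. For inversion
-- sequences, repeating e_n keeps the set of values and creates no (-,-,=) pattern because e_n was
-- not repeated before. For partition matrices, φ puts n + 1 into the entry of n. In an improper
-- matrix the column of n is an interval [α, n] in which k and k + 1 share an entry whenever
-- k ≡ α (mod 2); so the entry of n is odd exactly when n ≡ α, and then the column of n is odd too and
-- adding n + 1 does not change its semi-weight. Conversely, if the entry of n + 1 is even then
-- n + 1 ≢ α, so n and n + 1 share an entry and deleting n + 1 inverts φ.
module Submission where

import Data.Nat.Properties as ℕₚ

open import Defs
open import Data.Bool using (Bool; true; false; not; _∧_; _xor_)
import Data.Bool.Properties as Boolₚ
open import Algebra.Properties.CommutativeMonoid.Sum ℕₚ.+-0-commutativeMonoid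
  using (sum-syntax; sum-cong-≗; sum-remove; sum-replicate-zero; ∑-distrib-+) renaming (sum to ∑)
open import Data.Fin using (Fin; zero; suc; toℕ; fromℕ; inject₁; fromℕ<)
import Data.Fin.Properties as Finₚ
open import Data.Fin.Relation.Unary.Top using (view; ‵fromℕ; ‵inject₁)
open import Data.Fin.Subset using (Subset; _∈_; ∣_∣)
import Data.Fin.Subset as Subset
import Data.Fin.Subset.Properties as Subsetₚ
open import Data.List using (List; []; _∷_; _++_; [_]; filter; deduplicate; length)
import Data.List.Properties as Listₚ
open import Data.List.Relation.Unary.Any using (here; there)
open import Data.List.Membership.Propositional using () renaming (_∈_ to _∈ₗ_; _∉_ to _∉ₗ_)
open import Data.Nat using (ℕ; zero; suc; _+_; _≤_; _<_; z≤n; s≤s; _%_; ⌈_/2⌉)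
open import Data.Product using (Σ; ∃; ∃-syntax; _×_; _,_; proj₁; proj₂)
open import Data.Sum using (_⊎_; inj₁; inj₂)
import Data.Sum as Sum
open import Data.Vec using (Vec; []; _∷_; lookup; _∷ʳ_; init; last; toList; map)
import Data.Vec.Properties as Vecₚ
open import Data.Vec.Membership.Propositional using () renaming (_∈_ to _∈ᵥ_)
open import Data.Vec.Membership.Propositional.Properties using (∈-lookup; ∈-toList⁺)
open import Function using (_∘_; _⇔_; mk⇔; Equivalence)
open Equivalence using (to; from)
open import Function.Bundles using (_⤖_; Bijection; mk↔ₛ′)
open import Function.Properties.Inverse using (↔⇒⤖)
open import Relation.Nullary using (¬_; ¬?; yes; no; recompute; contradiction)
open import Relation.Unary using (Pred; Decidable)
open import Relation.Binary.Definitions using (DecidableEquality; Tri; tri<; tri≈; tri>)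
open import Relation.Binary.PropositionalEquality hiding ([_])

module _ {A : Set} where

  lookup-∷ʳ-inject₁ : ∀ {n} (xs : Vec A n) x i → lookup (xs ∷ʳ x) (inject₁ i) ≡ lookup xs i
  lookup-∷ʳ-inject₁ (_ ∷ _)  x zero    = refl
  lookup-∷ʳ-inject₁ (_ ∷ xs) x (suc i) = lookup-∷ʳ-inject₁ xs x i

  lookup-∷ʳ-fromℕ : ∀ {n} (xs : Vec A n) x → lookup (xs ∷ʳ x) (fromℕ n) ≡ x
  lookup-∷ʳ-fromℕ []       x = refl
  lookup-∷ʳ-fromℕ (_ ∷ xs) x = lookup-∷ʳ-fromℕ xs x

  init-∷ʳ-last : ∀ {n} (xs : Vec A (suc n)) → init xs ∷ʳ last xs ≡ xs
  init-∷ʳ-last xs = sym (proj₂ (proj₂ (Data.Vec.initLast xs)))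

  lookup-init : ∀ {n} (xs : Vec A (suc n)) i → lookup (init xs) i ≡ lookup xs (inject₁ i)
  lookup-init xs i = trans (sym (lookup-∷ʳ-inject₁ (init xs) (last xs) i))
                           (cong (λ ys → lookup ys (inject₁ i)) (init-∷ʳ-last xs))

  last≡lookup-fromℕ : ∀ {n} (xs : Vec A (suc n)) → last xs ≡ lookup xs (fromℕ n)
  last≡lookup-fromℕ xs = trans (sym (lookup-∷ʳ-fromℕ (init xs) (last xs)))
                               (cong (λ ys → lookup ys (fromℕ _)) (init-∷ʳ-last xs))

  repeatLast : ∀ {n} → Vec A (suc n) → Vec A (suc (suc n))
  repeatLast xs = xs ∷ʳ last xs

  repeatLast-init : ∀ {n} (xs : Vec A (suc (suc n))) → last (init xs) ≡ last xs → repeatLast (init xs) ≡ xs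
  repeatLast-init xs eq = trans (cong (init xs ∷ʳ_) eq) (init-∷ʳ-last xs)

  last-init≡lookup : ∀ {n} (xs : Vec A (suc (suc n))) → last (init xs) ≡ lookup xs (inject₁ (fromℕ n))
  last-init≡lookup xs = trans (last≡lookup-fromℕ (init xs)) (lookup-init xs (fromℕ _))

toℕ≡⇒≡fromℕ : ∀ {n} (k : Fin (suc n)) → toℕ k ≡ n → k ≡ fromℕ n
toℕ≡⇒≡fromℕ {n} k eq = Finₚ.toℕ-injective (trans eq (sym (Finₚ.toℕ-fromℕ n)))

elt≡⇒≡fromℕ : ∀ {n} (k : Fin (suc n)) → elt k ≡ suc n → k ≡ fromℕ n
elt≡⇒≡fromℕ k eq = toℕ≡⇒≡fromℕ k (ℕₚ.suc-injective eq)

elt-inject₁ : ∀ {n} (k : Fin n) → elt (inject₁ k) ≡ elt k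
elt-inject₁ k = cong suc (Finₚ.toℕ-inject₁ k)

elt-fromℕ : ∀ n → elt (fromℕ n) ≡ suc n
elt-fromℕ n = cong suc (Finₚ.toℕ-fromℕ n)

toℕ-inject₁-fromℕ : ∀ n → toℕ (inject₁ (fromℕ n)) ≡ n
toℕ-inject₁-fromℕ n = trans (Finₚ.toℕ-inject₁ (fromℕ n)) (Finₚ.toℕ-fromℕ n)

inject₁<fromℕ : ∀ {n} (k : Fin n) → toℕ (inject₁ k) < toℕ (fromℕ n)
inject₁<fromℕ {n} k = subst (toℕ (inject₁ k) <_) (sym (Finₚ.toℕ-fromℕ n)) (Finₚ.inject₁ℕ< k)

inject₁-cancel-< : ∀ {n} {i j : Fin n} → toℕ (inject₁ i) < toℕ (inject₁ j) → toℕ i < toℕ j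
inject₁-cancel-< {i = i} {j} = subst₂ _<_ (Finₚ.toℕ-inject₁ i) (Finₚ.toℕ-inject₁ j)

inject₁-mono-< : ∀ {n} {i j : Fin n} → toℕ i < toℕ j → toℕ (inject₁ i) < toℕ (inject₁ j)
inject₁-mono-< {i = i} {j} = subst₂ _<_ (sym (Finₚ.toℕ-inject₁ i)) (sym (Finₚ.toℕ-inject₁ j))

∃-least : ∀ {n p} {P : Pred (Fin n) p} → Decidable P → ∃ P →
          ∃ λ a → P a × (∀ k → P k → toℕ a ≤ toℕ k)
∃-least {suc n} P? (w , Pw) with P? zero
... | yes P0 = zero , P0 , λ _ _ → z≤n
∃-least {suc n} P? (zero  , Pw) | no ¬P0 = contradiction Pw ¬P0
∃-least {suc n} P? (suc w , Pw) | no ¬P0 with ∃-least (P? ∘ suc) (w , Pw)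
... | a , Pa , least = suc a , Pa , λ { zero P0 → contradiction P0 ¬P0 ; (suc k) Pk → s≤s (least k Pk) }

squash : ∀ {n} → Fin (suc (suc n)) → Fin (suc n)
squash {zero}  _       = zero
squash {suc n} zero    = zero
squash {suc n} (suc k) = suc (squash k)

squash-inject₁ : ∀ {n} (k : Fin (suc n)) → squash (inject₁ k) ≡ k
squash-inject₁ {zero}  zero    = refl
squash-inject₁ {suc n} zero    = refl
squash-inject₁ {suc n} (suc k) = cong suc (squash-inject₁ k)

squash-fromℕ : ∀ n → squash (fromℕ (suc n)) ≡ fromℕ n
squash-fromℕ zero    = refl
squash-fromℕ (suc n) = cong suc (squash-fromℕ n)

squash-≤ : ∀ {n} (k : Fin (suc (suc n))) → toℕ (squash k) ≤ toℕ k
squash-≤ {zero}  _       = z≤n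
squash-≤ {suc n} zero    = z≤n
squash-≤ {suc n} (suc k) = s≤s (squash-≤ k)

squash-cancel-< : ∀ {n} {i j : Fin (suc (suc n))} → toℕ (squash i) < toℕ (squash j) → toℕ i < toℕ j
squash-cancel-< {zero}  ()
squash-cancel-< {suc n} {zero}  {suc j} _ = s≤s z≤n
squash-cancel-< {suc n} {suc i} {suc j} (s≤s lt) = s≤s (squash-cancel-< lt)

lookup-repeatLast : ∀ {A : Set} {n} (xs : Vec A (suc n)) k → lookup (repeatLast xs) k ≡ lookup xs (squash k)
lookup-repeatLast {n = zero}  (x ∷ []) zero          = refl
lookup-repeatLast {n = zero}  (x ∷ []) (suc zero)    = refl
lookup-repeatLast {n = suc n} (x ∷ xs) zero          = refl
lookup-repeatLast {n = suc n} (x ∷ xs) (suc k)       = lookup-repeatLast xs k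

module _ {A : Set} (_≟_ : DecidableEquality A) where

  open import Data.List.Membership.DecPropositional _≟_ using (_∈?_)

  private
    dedup : List A → List A
    dedup = deduplicate _≟_

  deduplicate-++-∉ : ∀ xs {y} → y ∉ₗ xs → dedup (xs ++ [ y ]) ≡ dedup xs ++ [ y ]
  deduplicate-++-∉ []       _   = refl
  deduplicate-++-∉ (x ∷ xs) {y} y∉ = cong (x ∷_) (begin
    filter P (dedup (xs ++ [ y ]))          ≡⟨ cong (filter P) (deduplicate-++-∉ xs (y∉ ∘ there)) ⟩
    filter P (dedup xs ++ [ y ])            ≡⟨ Listₚ.filter-++ P (dedup xs) [ y ] ⟩
    filter P (dedup xs) ++ filter P [ y ]   ≡⟨ cong (filter P (dedup xs) ++_)
                                                 (Listₚ.filter-accept P (y∉ ∘ here ∘ sym)) ⟩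
    filter P (dedup xs) ++ [ y ]            ∎)
    where
    open ≡-Reasoning
    P = ¬? ∘ (x ≟_)

  deduplicate-++-∈ : ∀ xs {y} → y ∈ₗ xs → dedup (xs ++ [ y ]) ≡ dedup xs
  deduplicate-++-∈ (x ∷ xs) {y} y∈ with y ∈? xs | y∈
  ... | yes y∈xs | _ = cong (λ ys → x ∷ filter P ys) (deduplicate-++-∈ xs y∈xs)
    where P = ¬? ∘ (x ≟_)
  ... | no y∉xs | there y∈xs = contradiction y∈xs y∉xs
  ... | no y∉xs | here refl = cong (x ∷_) (begin
    filter P (dedup (xs ++ [ x ]))          ≡⟨ cong (filter P) (deduplicate-++-∉ xs y∉xs) ⟩
    filter P (dedup xs ++ [ x ])            ≡⟨ Listₚ.filter-++ P (dedup xs) [ x ] ⟩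
    filter P (dedup xs) ++ filter P [ x ]   ≡⟨ cong (filter P (dedup xs) ++_)
                                                 (Listₚ.filter-reject P (λ x≢x → x≢x refl)) ⟩
    filter P (dedup xs) ++ []               ≡⟨ Listₚ.++-identityʳ _ ⟩
    filter P (dedup xs)                     ∎)
    where
    open ≡-Reasoning
    P = ¬? ∘ (x ≟_)

dist-repeatLast : ∀ {n} (e : Vec ℕ (suc n)) → dist (repeatLast e) ≡ dist e
dist-repeatLast {n} e = cong length (begin
  deduplicate ℕₚ._≟_ (toList (e ∷ʳ last e))    ≡⟨ cong (deduplicate ℕₚ._≟_) (Vecₚ.toList-∷ʳ (last e) e) ⟩
  deduplicate ℕₚ._≟_ (toList e ++ [ last e ])  ≡⟨ deduplicate-++-∈ ℕₚ._≟_ (toList e) last∈e ⟩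
  deduplicate ℕₚ._≟_ (toList e)                ∎)
  where
  open ≡-Reasoning
  last∈e : last e ∈ₗ toList e
  last∈e = ∈-toList⁺ (subst (_∈ᵥ e) (sym (last≡lookup-fromℕ e)) (∈-lookup (fromℕ n) e))

-- Inversion sequences

avoids-∷ʳ : ∀ {n} {xs : Vec ℕ n} {x} → Avoids--= xs →
            (∀ i → suc (toℕ i) < n → lookup xs i ≢ x) → Avoids--= (xs ∷ʳ x)
avoids-∷ʳ {n} {xs} {x} av fresh i j k i<j j<k eq with view k | view j | view i
... | ‵inject₁ k′ | ‵inject₁ j′ | ‵inject₁ i′ =
  av i′ j′ k′ (inject₁-cancel-< i<j) (inject₁-cancel-< j<k)
     (trans (sym (lookup-∷ʳ-inject₁ xs x i′)) (trans eq (lookup-∷ʳ-inject₁ xs x k′)))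
... | ‵inject₁ k′ | ‵fromℕ      | _           = contradiction j<k (ℕₚ.<⇒≯ (inject₁<fromℕ k′))
... | ‵inject₁ k′ | ‵inject₁ j′ | ‵fromℕ      = contradiction i<j (ℕₚ.<⇒≯ (inject₁<fromℕ j′))
... | ‵fromℕ      | _           | ‵fromℕ      = ℕₚ.<-irrefl refl (ℕₚ.<-trans i<j j<k)
... | ‵fromℕ      | _           | ‵inject₁ i′ =
  fresh i′ (subst₂ (λ a b → suc a < b) (Finₚ.toℕ-inject₁ i′) (Finₚ.toℕ-fromℕ n)
                   (ℕₚ.≤-<-trans i<j j<k))
        (trans (sym (lookup-∷ʳ-inject₁ xs x i′)) (trans eq (lookup-∷ʳ-fromℕ xs x)))

-- Avoiding (-,-,=) already forbids e_i = e_n for i < n - 1; ¬ LastTwoEqual covers i = n - 1.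
last-fresh : ∀ {m} (e : Vec ℕ (suc m)) → Avoids--= e → ¬ LastTwoEqual e →
             ∀ i → suc (toℕ i) < suc m → lookup e i ≢ last e
last-fresh {m} e av ¬last₌ i i+1<n eq with suc (toℕ i) ℕₚ.≟ m
... | yes i+1≡m = ¬last₌ (i , fromℕ m , trans i+1≡m (sym (Finₚ.toℕ-fromℕ m)) , elt-fromℕ m ,
                          trans eq (last≡lookup-fromℕ e))
... | no i+1≢m = av i j (fromℕ m) i<j j<m (trans eq (last≡lookup-fromℕ e))
  where
  i+1<m : suc (toℕ i) < m
  i+1<m = ℕₚ.≤∧≢⇒< (Data.Nat.s≤s⁻¹ i+1<n) i+1≢m
  j : Fin (suc m)
  j = fromℕ< (ℕₚ.m<n⇒m<1+n i+1<m)
  toℕ-j : toℕ j ≡ suc (toℕ i)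
  toℕ-j = Finₚ.toℕ-fromℕ< (ℕₚ.m<n⇒m<1+n i+1<m)
  i<j : toℕ i < toℕ j
  i<j = subst (toℕ i <_) (sym toℕ-j) (ℕₚ.n<1+n (toℕ i))
  j<m : toℕ j < toℕ (fromℕ m)
  j<m = subst₂ _<_ (sym toℕ-j) (sym (Finₚ.toℕ-fromℕ m)) i+1<m

module _ {m : ℕ} where

  lastTwoEqual⇒ : (e : Vec ℕ (suc (suc m))) → LastTwoEqual e → last (init e) ≡ last e
  lastTwoEqual⇒ e (i , j , i+1≡j , j+1≡n , eq) with elt≡⇒≡fromℕ j j+1≡n
  ... | refl = begin
    last (init e)                 ≡⟨ last-init≡lookup e ⟩
    lookup e (inject₁ (fromℕ m))  ≡⟨ cong (lookup e) i≡ ⟨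
    lookup e i                    ≡⟨ eq ⟩
    lookup e (fromℕ (suc m))      ≡⟨ last≡lookup-fromℕ e ⟨
    last e                        ∎
    where
    open ≡-Reasoning
    i≡ : i ≡ inject₁ (fromℕ m)
    i≡ = Finₚ.toℕ-injective (trans (ℕₚ.suc-injective (trans i+1≡j (Finₚ.toℕ-fromℕ (suc m))))
                                   (sym (toℕ-inject₁-fromℕ m)))

  lastTwoEqual⇐ : (e : Vec ℕ (suc (suc m))) → last (init e) ≡ last e → LastTwoEqual e
  lastTwoEqual⇐ e eq = inject₁ (fromℕ m) , fromℕ (suc m) ,
    cong suc (trans (toℕ-inject₁-fromℕ m) (sym (Finₚ.toℕ-fromℕ m))) , elt-fromℕ (suc m) ,
    trans (sym (last-init≡lookup e)) (trans eq (last≡lookup-fromℕ e))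

  repeatLast-isInversionSeq : (e : Vec ℕ (suc m)) → IsInversionSeq e → IsInversionSeq (repeatLast e)
  repeatLast-isInversionSeq e inv k =
    subst (_< elt k) (sym (lookup-repeatLast e k)) (ℕₚ.<-≤-trans (inv (squash k)) (s≤s (squash-≤ k)))

  repeatLast-avoids : (e : Vec ℕ (suc m)) → Avoids--= e → ¬ LastTwoEqual e → Avoids--= (repeatLast e)
  repeatLast-avoids e av ¬last₌ = avoids-∷ʳ {xs = e} av (last-fresh e av ¬last₌)

  repeatLast-lastTwoEqual : (e : Vec ℕ (suc m)) → LastTwoEqual (repeatLast e)
  repeatLast-lastTwoEqual e = lastTwoEqual⇐ (repeatLast e)
    (trans (cong last (Vecₚ.init-∷ʳ (last e) e)) (sym (Vecₚ.last-∷ʳ (last e) e)))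

  init-isInversionSeq : (e : Vec ℕ (suc (suc m))) → IsInversionSeq e → IsInversionSeq (init e)
  init-isInversionSeq e inv k = subst₂ _<_ (sym (lookup-init e k)) (elt-inject₁ k) (inv (inject₁ k))

  init-avoids : (e : Vec ℕ (suc (suc m))) → Avoids--= e → Avoids--= (init e)
  init-avoids e av i j k i<j j<k eq = av (inject₁ i) (inject₁ j) (inject₁ k)
    (inject₁-mono-< i<j) (inject₁-mono-< j<k) (trans (sym (lookup-init e i)) (trans eq (lookup-init e k)))

  init-¬lastTwoEqual : (e : Vec ℕ (suc (suc m))) → Avoids--= e → LastTwoEqual e → ¬ LastTwoEqual (init e)
  init-¬lastTwoEqual e av last₌ (i , j , i+1≡j , j+1≡n , eq) with elt≡⇒≡fromℕ j j+1≡n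
  ... | refl = av (inject₁ i) (inject₁ (fromℕ m)) (fromℕ (suc m)) i<m (inject₁<fromℕ (fromℕ m)) (begin
      lookup e (inject₁ i)          ≡⟨ lookup-init e i ⟨
      lookup (init e) i             ≡⟨ eq ⟩
      lookup (init e) (fromℕ m)     ≡⟨ last≡lookup-fromℕ (init e) ⟨
      last (init e)                 ≡⟨ lastTwoEqual⇒ e last₌ ⟩
      last e                        ≡⟨ last≡lookup-fromℕ e ⟩
      lookup e (fromℕ (suc m))      ∎)
    where
    open ≡-Reasoning
    i<m : toℕ (inject₁ i) < toℕ (inject₁ (fromℕ m))
    i<m = subst₂ _<_ (sym (Finₚ.toℕ-inject₁ i)) (sym (toℕ-inject₁-fromℕ m))
                 (ℕₚ.≤-reflexive (trans i+1≡j (Finₚ.toℕ-fromℕ m)))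

  ψ : InvSeq⁻ (suc m) ⤖ InvSeq⁺ (suc (suc m))
  ψ = ↔⇒⤖ (mk↔ₛ′ forth back forth∘back back∘forth)
    where
    forth : InvSeq⁻ (suc m) → InvSeq⁺ (suc (suc m))
    forth (inv⁻ e inv av ¬last₌) = inv⁺ (repeatLast e)
      (repeatLast-isInversionSeq e inv) (repeatLast-avoids e av ¬last₌) (repeatLast-lastTwoEqual e)
    back : InvSeq⁺ (suc (suc m)) → InvSeq⁻ (suc m)
    back (inv⁺ e inv av last₌) =
      inv⁻ (init e) (init-isInversionSeq e inv) (init-avoids e av) (init-¬lastTwoEqual e av last₌)
    inv⁺-cong : ∀ {e e′} .{i i′ a a′ l l′} → e ≡ e′ → inv⁺ e i a l ≡ inv⁺ e′ i′ a′ l′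
    inv⁺-cong refl = refl
    inv⁻-cong : ∀ {e e′} .{i i′ a a′ l l′} → e ≡ e′ → inv⁻ {suc m} e i a l ≡ inv⁻ e′ i′ a′ l′
    inv⁻-cong refl = refl
    forth∘back : ∀ e → forth (back e) ≡ e
    forth∘back (inv⁺ e _ _ last₌) = inv⁺-cong (repeatLast-init e
      (recompute (last (init e) ℕₚ.≟ last e) (lastTwoEqual⇒ e last₌)))
    back∘forth : ∀ e → back (forth e) ≡ e
    back∘forth (inv⁻ e _ _ _) = inv⁻-cong (Vecₚ.init-∷ʳ (last e) e)

  dist-ψ : ∀ e → dist (InvSeq⁺.seq (Bijection.to ψ e)) ≡ dist (InvSeq⁻.seq e)
  dist-ψ (inv⁻ e _ _ _) = dist-repeatLast e

-- Counting and parity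

odd : ℕ → Bool
odd zero          = false
odd (suc zero)    = true
odd (suc (suc n)) = odd n

even : ℕ → Bool
even n = not (odd n)

bit : Bool → ℕ
bit false = 0
bit true  = 1

odd-suc : ∀ n → odd (suc n) ≡ not (odd n)
odd-suc zero          = refl
odd-suc (suc zero)    = refl
odd-suc (suc (suc n)) = odd-suc n

odd-+ : ∀ m n → odd (m + n) ≡ odd m xor odd n
odd-+ zero          n = refl
odd-+ (suc zero)    n = odd-suc n
odd-+ (suc (suc m)) n = odd-+ m n

odd-bit : ∀ b → odd (bit b) ≡ b
odd-bit false = refl
odd-bit true  = refl

bit-injective : ∀ {a b} → bit a ≡ bit b → a ≡ b
bit-injective {false} {false} _ = refl
bit-injective {true}  {true}  _ = refl

%2≡bit-odd : ∀ n → n % 2 ≡ bit (odd n)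
%2≡bit-odd zero          = refl
%2≡bit-odd (suc zero)    = refl
%2≡bit-odd (suc (suc n)) = %2≡bit-odd n

%2≡bit⇒odd≡ : ∀ n {b} → n % 2 ≡ bit b → odd n ≡ b
%2≡bit⇒odd≡ n eq = bit-injective (trans (sym (%2≡bit-odd n)) eq)

%2-cong-odd : ∀ {m n} → odd m ≡ odd n → m % 2 ≡ n % 2
%2-cong-odd {m} {n} eq = trans (%2≡bit-odd m) (trans (cong bit eq) (sym (%2≡bit-odd n)))

odd-+≡false⇒odd≡odd : ∀ m n → odd (m + n) ≡ false → odd m ≡ odd n
odd-+≡false⇒odd≡odd m n eq with odd m | odd n | trans (sym (odd-+ m n)) eq
... | false | false | _ = refl
... | true  | true  | _ = refl

odd-n+n : ∀ n → odd (n + n) ≡ false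
odd-n+n n = trans (odd-+ n n) (Boolₚ.xor-same (odd n))

%2≡1⇔1+%2≡0 : ∀ n → n % 2 ≡ 1 ⇔ suc n % 2 ≡ 0
%2≡1⇔1+%2≡0 zero          = mk⇔ (λ ()) (λ ())
%2≡1⇔1+%2≡0 (suc zero)    = mk⇔ (λ _ → refl) (λ _ → refl)
%2≡1⇔1+%2≡0 (suc (suc n)) = %2≡1⇔1+%2≡0 n

⌈1+n/2⌉≡⌈n/2⌉ : ∀ n → odd n ≡ true → ⌈ suc n /2⌉ ≡ ⌈ n /2⌉
⌈1+n/2⌉≡⌈n/2⌉ (suc zero)    _   = refl
⌈1+n/2⌉≡⌈n/2⌉ (suc (suc n)) odd = cong suc (⌈1+n/2⌉≡⌈n/2⌉ n odd)

-- A subset that is empty below a and contains k iff it contains k + 1 whenever k ≥ a has the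
-- same parity as a is a union of pairs {k, k + 1}, except for a lone top element m when m ≡ a.
odd-∣∣-paired : ∀ {m} (s : Subset (suc m)) a →
  (∀ k → toℕ k < a → lookup s k ≡ false) →
  (∀ k k′ → toℕ k′ ≡ suc (toℕ k) → a ≤ toℕ k → odd (toℕ k) ≡ odd a →
           lookup s k ≡ lookup s k′) →
  odd ∣ s ∣ ≡ even (m + a) ∧ lookup s (fromℕ m)
odd-∣∣-paired {zero} (b ∷ []) (suc a) below _ rewrite below zero (s≤s z≤n) = sym (Boolₚ.∧-zeroʳ _)
odd-∣∣-paired {suc m} (b ∷ s) (suc a) below paired rewrite below zero (s≤s z≤n) | ℕₚ.+-suc m a =
  odd-∣∣-paired s a (λ k k<a → below (suc k) (s≤s k<a))
    (λ k k′ k′≡ a≤k same → paired (suc k) (suc k′) (cong suc k′≡) (s≤s a≤k)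
                                   (trans (odd-suc (toℕ k)) (trans (cong not same) (sym (odd-suc a)))))
odd-∣∣-paired {zero} (true ∷ [])  zero _ _ = refl
odd-∣∣-paired {zero} (false ∷ []) zero _ _ = refl
odd-∣∣-paired {suc m} (b ∷ b′ ∷ s) zero below paired with paired zero (suc zero) refl z≤n refl
odd-∣∣-paired {suc zero} (b ∷ .b ∷ []) zero below paired | refl with b
... | true  = refl
... | false = refl
odd-∣∣-paired {suc (suc m)} (b ∷ .b ∷ s) zero below paired | refl =
  trans (odd-∣b∷b∷s∣ b) (odd-∣∣-paired s zero (λ _ ())
    (λ k k′ k′≡ _ same → paired (suc (suc k)) (suc (suc k′)) (cong (λ x → suc (suc x)) k′≡) z≤n same))
  where
  odd-∣b∷b∷s∣ : ∀ b → odd ∣ b ∷ b ∷ s ∣ ≡ odd ∣ s ∣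
  odd-∣b∷b∷s∣ true  = refl
  odd-∣b∷b∷s∣ false = refl

sum-map≡∑ : ∀ {A : Set} {n} (f : A → ℕ) (xs : Vec A n) → Data.Vec.sum (map f xs) ≡ ∑[ i < n ] f (lookup xs i)
sum-map≡∑ f []       = refl
sum-map≡∑ f (x ∷ xs) = cong (f x +_) (sum-map≡∑ f xs)

∑-zero : ∀ {n} (f : Fin n → ℕ) → (∀ i → f i ≡ 0) → ∑ f ≡ 0
∑-zero {n} f f≡0 = trans (sum-cong-≗ f≡0) (sum-replicate-zero n)

∑-unique : ∀ {n} (f : Fin n → ℕ) i → f i ≡ 1 → (∀ j → j ≢ i → f j ≡ 0) → ∑ f ≡ 1
∑-unique {suc _} f i fi≡1 others≡0 = trans (sum-remove {i = i} f) (cong₂ _+_ fi≡1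
  (∑-zero _ (λ j → others≡0 _ (Finₚ.punchInᵢ≢i i j))))

odd-∑-cong : ∀ {n} (f g : Fin n → ℕ) → (∀ i → odd (f i) ≡ odd (g i)) → odd (∑ f) ≡ odd (∑ g)
odd-∑-cong {zero}  f g _    = refl
odd-∑-cong {suc n} f g same = begin
  odd (f zero + ∑ (f ∘ suc))          ≡⟨ odd-+ (f zero) _ ⟩
  odd (f zero) xor odd (∑ (f ∘ suc))  ≡⟨ cong₂ _xor_ (same zero) (odd-∑-cong _ _ (same ∘ suc)) ⟩
  odd (g zero) xor odd (∑ (g ∘ suc))  ≡⟨ odd-+ (g zero) _ ⟨
  odd (g zero + ∑ (g ∘ suc))          ∎
  where open ≡-Reasoning

∈⇔lookup≡true : ∀ {n} {k : Fin n} {s : Subset n} → k ∈ s ⇔ lookup s k ≡ true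
∈⇔lookup≡true {k = k} {s} = mk⇔ Vecₚ.[]=⇒lookup (Vecₚ.lookup⇒[]= k s)

∣∷ʳ∣ : ∀ {n} (s : Subset n) b → ∣ s ∷ʳ b ∣ ≡ ∣ s ∣ + bit b
∣∷ʳ∣ []          true  = refl
∣∷ʳ∣ []          false = refl
∣∷ʳ∣ (true ∷ s)  b     = cong suc (∣∷ʳ∣ s b)
∣∷ʳ∣ (false ∷ s) b     = ∣∷ʳ∣ s b

∣repeatLast∣ : ∀ {n} (s : Subset (suc n)) → ∣ repeatLast s ∣ ≡ ∣ s ∣ + bit (lookup s (fromℕ n))
∣repeatLast∣ s = trans (∣∷ʳ∣ s (last s)) (cong (λ b → ∣ s ∣ + bit b) (last≡lookup-fromℕ s))

repeatLast-⊥ : ∀ n → repeatLast (Subset.⊥ {suc n}) ≡ Subset.⊥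
repeatLast-⊥ zero    = refl
repeatLast-⊥ (suc n) = cong (false ∷_) (repeatLast-⊥ n)

repeatLast≡⊥⇒≡⊥ : ∀ {n} (s : Subset (suc n)) → repeatLast s ≡ Subset.⊥ → s ≡ Subset.⊥
repeatLast≡⊥⇒≡⊥ {n} s eq = begin
  s                           ≡⟨ Vecₚ.init-∷ʳ (last s) s ⟨
  init (repeatLast s)         ≡⟨ cong init eq ⟩
  init (Subset.⊥ {suc (suc n)}) ≡⟨ cong init (repeatLast-⊥ n) ⟨
  init (repeatLast Subset.⊥)  ≡⟨ Vecₚ.init-∷ʳ _ Subset.⊥ ⟩
  Subset.⊥                    ∎
  where open ≡-Reasoning

∈repeatLast⇔ : ∀ {n} {s : Subset (suc n)} {k} → k ∈ repeatLast s ⇔ squash k ∈ s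
∈repeatLast⇔ {s = s} {k} = mk⇔
  (λ k∈ → from ∈⇔lookup≡true (trans (sym (lookup-repeatLast s k)) (to ∈⇔lookup≡true k∈)))
  (λ k∈ → from ∈⇔lookup≡true (trans (lookup-repeatLast s k) (to ∈⇔lookup≡true k∈)))

-- Partition matrices

mapEntries : ∀ {n n′ D} → (Subset n → Subset n′) → Matrix n D → Matrix n′ D
mapEntries f = map (map f)

entry-mapEntries : ∀ {n n′ D} (f : Subset n → Subset n′) (M : Matrix n D) r c →
                   entry (mapEntries f M) r c ≡ f (entry M r c)
entry-mapEntries f M r c =
  trans (cong (λ row → lookup row c) (Vecₚ.lookup-map r (map f) M)) (Vecₚ.lookup-map c f (lookup M r))

lookup-ext : ∀ {A : Set} {n} {xs ys : Vec A n} → (∀ i → lookup xs i ≡ lookup ys i) → xs ≡ ys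
lookup-ext {xs = xs} {ys} eq =
  trans (sym (Vecₚ.tabulate∘lookup xs)) (trans (Vecₚ.tabulate-cong eq) (Vecₚ.tabulate∘lookup ys))

matrix-ext : ∀ {n D} {M N : Matrix n D} → (∀ r c → entry M r c ≡ entry N r c) → M ≡ N
matrix-ext eq = lookup-ext (λ r → lookup-ext (eq r))

colSize≡∑ : ∀ {n D} (M : Matrix n D) c → colSize M c ≡ ∑[ r < D ] ∣ entry M r c ∣
colSize≡∑ M c = sum-map≡∑ (λ row → ∣ lookup row c ∣) M

occurrences : ∀ {n D} → Matrix n D → Fin D → Fin n → ℕ
occurrences {D = D} M c k = ∑[ r < D ] bit (lookup (entry M r c) k)

-- IsDescent M i and IsAscent M i are, definitionally, ColumnStep (λ r r′ → r′ < r) M i and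
-- ColumnStep (λ r r′ → r < r′) M i.
ColumnStep : ∀ {n D} → (Fin D → Fin D → Set) → Matrix n D → Fin n → Set
ColumnStep {n} R M i = (1 < elt i) × (elt i < n) ×
  (∃[ j ] (elt j ≡ suc (elt i)) ×
    (∃[ c ] ∃[ r ] ∃[ r′ ] (i ∈ entry M r c) × (j ∈ entry M r′ c) × R r r′))

module PartitionMatrixProperties {n D} {M : Matrix n D} (isPM : IsPartitionMatrix M) where

  open IsPartitionMatrix isPM

  row≤col : ∀ {k r c} → k ∈ entry M r c → toℕ r ≤ toℕ c
  row≤col {k} {r} {c} k∈ with toℕ r ℕₚ.≤? toℕ c
  ... | yes r≤c = r≤c
  ... | no  r≰c = contradiction (subst (k ∈_) (upper r c (ℕₚ.≰⇒> r≰c)) k∈) Subsetₚ.∉⊥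

  first∈column₀ : ∀ {k r c} → toℕ k ≡ 0 → k ∈ entry M r c → toℕ c ≡ 0
  first∈column₀ {c = zero}  _    _  = refl
  first∈column₀ {k} {r} {c = suc c} k≡0 k∈ with colNonempty zero
  ... | r₀ , x , x∈ = contradiction (colOrder x k r₀ zero r (suc c) x∈ k∈ (s≤s z≤n))
                                    (subst (λ e → ¬ elt x < e) (cong suc (sym k≡0)) (λ { (s≤s ()) }))

  lookup-elsewhere : ∀ {k r₀ c₀ r c} → k ∈ entry M r₀ c₀ → ¬ (r ≡ r₀ × c ≡ c₀) →
                     lookup (entry M r c) k ≡ false
  lookup-elsewhere {k} {r = r} {c} k∈ elsewhere with lookup (entry M r c) k in eq
  ... | false = refl
  ... | true  = contradiction (disjoint k r c _ _ (from ∈⇔lookup≡true eq) k∈) elsewhere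

  lookup≡-sameEntry : ∀ {k k′ r₀ c₀} → k ∈ entry M r₀ c₀ → k′ ∈ entry M r₀ c₀ →
                      ∀ r c → lookup (entry M r c) k ≡ lookup (entry M r c) k′
  lookup≡-sameEntry {k} {k′} k∈ k′∈ r c with lookup (entry M r c) k in eq | lookup (entry M r c) k′ in eq′
  ... | true  | true  = refl
  ... | false | false = refl
  ... | true  | false with disjoint k r c _ _ (from ∈⇔lookup≡true eq) k∈
  ...   | refl , refl = trans (sym (to ∈⇔lookup≡true k′∈)) eq′
  lookup≡-sameEntry {k} {k′} k∈ k′∈ r c | false | true
    with disjoint k′ r c _ _ (from ∈⇔lookup≡true eq′) k′∈
  ...   | refl , refl = trans (sym eq) (to ∈⇔lookup≡true k∈)

  occurrences-∈ : ∀ {k r₀ c} → k ∈ entry M r₀ c → occurrences M c k ≡ 1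
  occurrences-∈ {k} {r₀} k∈ = ∑-unique _ r₀ (cong bit (to ∈⇔lookup≡true k∈))
    (λ r r≢r₀ → cong bit (lookup-elsewhere k∈ (r≢r₀ ∘ proj₁)))

  occurrences-∉ : ∀ {k r₀ c₀ c} → k ∈ entry M r₀ c₀ → c ≢ c₀ → occurrences M c k ≡ 0
  occurrences-∉ {k} {c = c} k∈ c≢c₀ =
    ∑-zero (λ r → bit (lookup (entry M r c) k)) (λ r → cong bit (lookup-elsewhere k∈ (c≢c₀ ∘ proj₂)))

-- The column of the last element m of an improper partition matrix consists of all elements from
-- its minimum α on; improperness forces k and k + 1 into the same entry whenever k ≡ α (mod 2).
module LastColumn {m D} {M : Matrix (suc m) D} (isPM : IsPartitionMatrix M) (improper : AllImproper M)
                  (c : Fin D) (last∈c : InColumn M c (fromℕ m)) where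

  open IsPartitionMatrix isPM
  open PartitionMatrixProperties isPM

  private
    least : ∃ λ a → InColumn M c a × (∀ k → InColumn M c k → toℕ a ≤ toℕ k)
    least = ∃-least (λ k → Finₚ.any? (λ r → k Subsetₚ.∈? entry M r c)) (fromℕ m , last∈c)

  α : Fin (suc m)
  α = proj₁ least

  α∈c : InColumn M c α
  α∈c = proj₁ (proj₂ least)

  α-least : ∀ k → InColumn M c k → toℕ α ≤ toℕ k
  α-least = proj₂ (proj₂ least)

  α≤⇒∈c : ∀ k → toℕ α ≤ toℕ k → InColumn M c k
  α≤⇒∈c k α≤k with covers k
  ... | r , c′ , k∈ with Finₚ.<-cmp c′ c
  ... | tri≈ _ refl _ = r , k∈
  ... | tri< c′<c _ _ = contradiction (colOrder k α r c′ (proj₁ α∈c) c k∈ (proj₂ α∈c) c′<c)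
                                      (ℕₚ.≤⇒≯ (s≤s α≤k))
  ... | tri> _ _ c<c′ = contradiction (colOrder (fromℕ m) k (proj₁ last∈c) c r c′ (proj₂ last∈c) k∈ c<c′)
                                      (ℕₚ.≤⇒≯ (s≤s (Finₚ.≤fromℕ k)))

  pairedRows : ∀ {k k′ r r′} → k ∈ entry M r c → k′ ∈ entry M r′ c → toℕ k′ ≡ suc (toℕ k) →
               odd (toℕ k) ≡ odd (toℕ α) → r ≡ r′
  pairedRows {zero} k∈ k′∈ _ _ = Finₚ.toℕ-injective (trans (row₀ k∈) (sym (row₀ k′∈)))
    where
    row₀ : ∀ {x r} → x ∈ entry M r c → toℕ r ≡ 0
    row₀ x∈ = ℕₚ.n≤0⇒n≡0 (subst (_ ≤_) (first∈column₀ refl k∈) (row≤col x∈))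
  pairedRows {suc k} {k′} {r} {r′} k∈ k′∈ k′≡ same = rows-equal (Finₚ.<-cmp r r′)
    where
    step : ∀ {R : Fin D → Fin D → Set} → R r r′ → ColumnStep R M (suc k)
    step rr = s≤s (s≤s z≤n) , s≤s (subst (_≤ m) k′≡ (Finₚ.toℕ≤pred[n] k′)) , k′ , cong suc k′≡ ,
              c , r , r′ , k∈ , k′∈ , rr
    proper : IsProper M (suc k)
    proper = c , α , (r , k∈) , (α∈c , λ j j∈ → s≤s (α-least j j∈)) ,
             %2-cong-odd {elt (suc k)} {elt α}
               (trans (odd-suc (suc (toℕ k))) (trans (cong not same) (sym (odd-suc (toℕ α)))))
    rows-equal : Tri (toℕ r < toℕ r′) (r ≡ r′) (toℕ r′ < toℕ r) → r ≡ r′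
    rows-equal (tri≈ _ r≡r′ _) = r≡r′
    rows-equal (tri< r<r′ _ _) = contradiction proper (improper (suc k) (inj₂ (step r<r′)))
    rows-equal (tri> _ _ r′<r) = contradiction proper (improper (suc k) (inj₁ (step r′<r)))

  paired : ∀ {k k′} → toℕ k′ ≡ suc (toℕ k) → toℕ α ≤ toℕ k → odd (toℕ k) ≡ odd (toℕ α) →
           ∀ r → lookup (entry M r c) k ≡ lookup (entry M r c) k′
  paired {k} {k′} k′≡ α≤k same r
    with α≤⇒∈c k α≤k | α≤⇒∈c k′ (ℕₚ.≤-trans α≤k (subst (toℕ k ≤_) (sym k′≡) (ℕₚ.n≤1+n _)))
  ... | _ , k∈ | _ , k′∈ with pairedRows k∈ k′∈ k′≡ same
  ... | refl = lookup≡-sameEntry k∈ k′∈ r c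

  below-α : ∀ {r} k → toℕ k < toℕ α → lookup (entry M r c) k ≡ false
  below-α {r} k k<α with lookup (entry M r c) k in eq
  ... | false = refl
  ... | true  = contradiction (α-least k (r , from ∈⇔lookup≡true eq)) (ℕₚ.<⇒≱ k<α)

  odd-∣entry∣ : ∀ r → odd ∣ entry M r c ∣ ≡ even (m + toℕ α) ∧ lookup (entry M r c) (fromℕ m)
  odd-∣entry∣ r = odd-∣∣-paired (entry M r c) (toℕ α) below-α
                                (λ _ _ k′≡ α≤k same → paired k′≡ α≤k same r)

  odd-∣entry-of-last∣ : ∀ {r} → fromℕ m ∈ entry M r c → odd ∣ entry M r c ∣ ≡ even (m + toℕ α)
  odd-∣entry-of-last∣ {r} last∈ = trans (odd-∣entry∣ r)
    (trans (cong (even (m + toℕ α) ∧_) (to ∈⇔lookup≡true last∈)) (Boolₚ.∧-identityʳ _))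

  odd-colSize : even (m + toℕ α) ≡ true → odd (colSize M c) ≡ true
  odd-colSize m≡α = begin
    odd (colSize M c)                  ≡⟨ cong odd (colSize≡∑ M c) ⟩
    odd (∑[ r < D ] ∣ entry M r c ∣)    ≡⟨ odd-∑-cong _ _ (λ r → trans (odd-∣entry∣ r)
                                            (trans (cong (_∧ _) m≡α) (sym (odd-bit _)))) ⟩
    odd (occurrences M c (fromℕ m))    ≡⟨ cong odd (occurrences-∈ (proj₂ last∈c)) ⟩
    true                               ∎
    where open ≡-Reasoning

-- Adding n + 1 to the entry containing n

extend : ∀ {m D} → Matrix (suc m) D → Matrix (suc (suc m)) D
extend = mapEntries repeatLast

restrict : ∀ {m D} → Matrix (suc (suc m)) D → Matrix (suc m) D
restrict = mapEntries init

module _ {m D} {M : Matrix (suc m) D} where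

  ∈extend⇔ : ∀ {k r c} → k ∈ entry (extend M) r c ⇔ squash k ∈ entry M r c
  ∈extend⇔ {k} {r} {c} = subst (λ s → (k ∈ s) ⇔ (squash k ∈ entry M r c))
                                (sym (entry-mapEntries repeatLast M r c)) ∈repeatLast⇔

  inject₁∈extend⇔ : ∀ {k r c} → inject₁ k ∈ entry (extend M) r c ⇔ k ∈ entry M r c
  inject₁∈extend⇔ {k} {r} {c} = subst (λ x → (inject₁ k ∈ entry (extend M) r c) ⇔ (x ∈ entry M r c))
                                      (squash-inject₁ k) ∈extend⇔

  fromℕ∈extend⇔ : ∀ {r c} → fromℕ (suc m) ∈ entry (extend M) r c ⇔ fromℕ m ∈ entry M r c
  fromℕ∈extend⇔ {r} {c} = subst (λ x → (fromℕ (suc m) ∈ entry (extend M) r c) ⇔ (x ∈ entry M r c))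
                                (squash-fromℕ m) ∈extend⇔

  ∣entry-extend∣ : ∀ {r c} → fromℕ m ∈ entry M r c → ∣ entry (extend M) r c ∣ ≡ suc ∣ entry M r c ∣
  ∣entry-extend∣ {r} {c} last∈ = begin
    ∣ entry (extend M) r c ∣           ≡⟨ cong ∣_∣ (entry-mapEntries repeatLast M r c) ⟩
    ∣ repeatLast (entry M r c) ∣       ≡⟨ ∣repeatLast∣ (entry M r c) ⟩
    ∣ entry M r c ∣ + bit (lookup (entry M r c) (fromℕ m))
                                       ≡⟨ cong (λ b → ∣ entry M r c ∣ + bit b) (to ∈⇔lookup≡true last∈) ⟩
    ∣ entry M r c ∣ + 1                ≡⟨ ℕₚ.+-comm _ 1 ⟩
    suc ∣ entry M r c ∣                ∎
    where open ≡-Reasoning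

  colSize-extend : ∀ c → colSize (extend M) c ≡ colSize M c + occurrences M c (fromℕ m)
  colSize-extend c = begin
    colSize (extend M) c                                   ≡⟨ colSize≡∑ (extend M) c ⟩
    ∑[ r < D ] ∣ entry (extend M) r c ∣                     ≡⟨ sum-cong-≗ (λ r →
                                                                trans (cong ∣_∣ (entry-mapEntries repeatLast M r c))
                                                                      (∣repeatLast∣ (entry M r c))) ⟩
    ∑[ r < D ] (∣ entry M r c ∣ + bit (lookup (entry M r c) (fromℕ m)))
                                                           ≡⟨ ∑-distrib-+ (λ r → ∣ entry M r c ∣) _ ⟩
    ∑[ r < D ] ∣ entry M r c ∣ + occurrences M c (fromℕ m)  ≡⟨ cong (_+ occurrences M c (fromℕ m)) (colSize≡∑ M c) ⟨
    colSize M c + occurrences M c (fromℕ m)                ∎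
    where open ≡-Reasoning

  extend-isPM : IsPartitionMatrix M → IsPartitionMatrix (extend M)
  extend-isPM isPM = record
    { upper       = λ r c c<r → trans (entry-mapEntries repeatLast M r c)
                                      (trans (cong repeatLast (upper r c c<r)) (repeatLast-⊥ m))
    ; rowNonempty = λ r → let c , k , k∈ = rowNonempty r in c , inject₁ k , from inject₁∈extend⇔ k∈
    ; colNonempty = λ c → let r , k , k∈ = colNonempty c in r , inject₁ k , from inject₁∈extend⇔ k∈
    ; covers      = λ k → let r , c , k∈ = covers (squash k) in r , c , from ∈extend⇔ k∈
    ; disjoint    = λ k r c r′ c′ k∈ k∈′ →
                      disjoint (squash k) r c r′ c′ (to ∈extend⇔ k∈) (to ∈extend⇔ k∈′)
    ; colOrder    = λ i j ri ci rj cj i∈ j∈ ci<cj → s≤s (squash-cancel-< (Data.Nat.s<s⁻¹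
                      (colOrder (squash i) (squash j) ri ci rj cj (to ∈extend⇔ i∈) (to ∈extend⇔ j∈) ci<cj)))
    }
    where open IsPartitionMatrix isPM

  extend-isPM⁻¹ : IsPartitionMatrix (extend M) → IsPartitionMatrix M
  extend-isPM⁻¹ isPM = record
    { upper       = λ r c c<r → repeatLast≡⊥⇒≡⊥ (entry M r c)
                                  (trans (sym (entry-mapEntries repeatLast M r c)) (upper r c c<r))
    ; rowNonempty = λ r → let c , k , k∈ = rowNonempty r in c , squash k , to ∈extend⇔ k∈
    ; colNonempty = λ c → let r , k , k∈ = colNonempty c in r , squash k , to ∈extend⇔ k∈
    ; covers      = λ k → let r , c , k∈ = covers (inject₁ k) in r , c , to inject₁∈extend⇔ k∈
    ; disjoint    = λ k r c r′ c′ k∈ k∈′ →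
                      disjoint (inject₁ k) r c r′ c′ (from inject₁∈extend⇔ k∈) (from inject₁∈extend⇔ k∈′)
    ; colOrder    = λ i j ri ci rj cj i∈ j∈ ci<cj → subst₂ _<_ (elt-inject₁ i) (elt-inject₁ j)
                      (colOrder (inject₁ i) (inject₁ j) ri ci rj cj
                                (from inject₁∈extend⇔ i∈) (from inject₁∈extend⇔ j∈) ci<cj)
    }
    where open IsPartitionMatrix isPM

  columnStep-extend : ∀ {R i} → ColumnStep R M i → ColumnStep R (extend M) (inject₁ i)
  columnStep-extend {i = i} (1<i , i<n , j , j≡ , c , r , r′ , i∈ , j∈ , rr) =
    subst (1 <_) (sym (elt-inject₁ i)) 1<i , ℕₚ.m<n⇒m<1+n (subst (_< suc m) (sym (elt-inject₁ i)) i<n) ,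
    inject₁ j , trans (elt-inject₁ j) (trans j≡ (cong suc (sym (elt-inject₁ i)))) ,
    c , r , r′ , from inject₁∈extend⇔ i∈ , from inject₁∈extend⇔ j∈ , rr

  columnStep-extend⁻¹ : ∀ {R i} → IsPartitionMatrix M → (∀ {r r′} → R r r′ → r ≢ r′) →
                        ColumnStep R (extend M) (inject₁ i) → ColumnStep R M i
  columnStep-extend⁻¹ {i = i} isPM R⇒≢ (1<i , _ , j , j≡ , c , r , r′ , i∈ , j∈ , rr) with view j
  ... | ‵inject₁ j′ = subst (1 <_) (elt-inject₁ i) 1<i , subst (_≤ suc m) j′≡ (s≤s (Finₚ.toℕ≤pred[n] j′)) ,
                      j′ , j′≡ , c , r , r′ , to inject₁∈extend⇔ i∈ , to inject₁∈extend⇔ j∈ , rr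
    where
    j′≡ : elt j′ ≡ suc (elt i)
    j′≡ = trans (sym (elt-inject₁ j′)) (trans j≡ (cong suc (elt-inject₁ i)))
  ... | ‵fromℕ = contradiction (proj₁ (IsPartitionMatrix.disjoint isPM (fromℕ m) r c r′ c
                                 (subst (λ x → x ∈ entry M r c) i≡m (to inject₁∈extend⇔ i∈))
                                 (to fromℕ∈extend⇔ j∈)))
                               (R⇒≢ rr)
    where
    i≡m : i ≡ fromℕ m
    i≡m = toℕ≡⇒≡fromℕ i (trans (sym (Finₚ.toℕ-inject₁ i))
            (ℕₚ.suc-injective (ℕₚ.suc-injective (trans (sym j≡) (elt-fromℕ (suc m))))))

  proper-extend : ∀ {i} → IsProper M i → IsProper (extend M) (inject₁ i)
  proper-extend {i} (c , a , (r , i∈) , ((ra , a∈) , a-least) , same) =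
    c , inject₁ a , (r , from inject₁∈extend⇔ i∈) , ((ra , from inject₁∈extend⇔ a∈) , least) ,
    subst₂ (λ x y → x % 2 ≡ y % 2) (sym (elt-inject₁ i)) (sym (elt-inject₁ a)) same
    where
    least : ∀ k → InColumn (extend M) c k → elt (inject₁ a) ≤ elt k
    least k (rk , k∈) = subst (_≤ elt k) (sym (elt-inject₁ a))
      (ℕₚ.≤-trans (a-least (squash k) (rk , to ∈extend⇔ k∈)) (s≤s (squash-≤ k)))

  proper-extend⁻¹ : ∀ {i} → IsProper (extend M) (inject₁ i) → IsProper M i
  proper-extend⁻¹ {i} (c , a , (r , i∈) , ((ra , a∈) , a-least) , same) with view a
  ... | ‵inject₁ a′ =
    c , a′ , (r , to inject₁∈extend⇔ i∈) , ((ra , to inject₁∈extend⇔ a∈) , least) ,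
    subst₂ (λ x y → x % 2 ≡ y % 2) (elt-inject₁ i) (elt-inject₁ a′) same
    where
    least : ∀ k → InColumn M c k → elt a′ ≤ elt k
    least k (rk , k∈) = subst₂ _≤_ (elt-inject₁ a′) (elt-inject₁ k)
      (a-least (inject₁ k) (rk , from inject₁∈extend⇔ k∈))
  ... | ‵fromℕ = contradiction (a-least (inject₁ i) (r , i∈)) (ℕₚ.<⇒≱ (s≤s (inject₁<fromℕ i)))

  extend-improper : IsPartitionMatrix M → AllImproper M → AllImproper (extend M)
  extend-improper isPM improper i step proper with view i
  ... | ‵inject₁ i′ = improper i′
    (Sum.map (columnStep-extend⁻¹ isPM (λ r′<r r≡r′ → Finₚ.<⇒≢ r′<r (sym r≡r′)))
             (columnStep-extend⁻¹ isPM Finₚ.<⇒≢) step)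
    (proper-extend⁻¹ proper)
  ... | ‵fromℕ = ℕₚ.<-irrefl (elt-fromℕ (suc m)) (elt<n step)
    where
    elt<n : ∀ {k} → IsDescent (extend M) k ⊎ IsAscent (extend M) k → elt k < suc (suc m)
    elt<n (inj₁ (_ , k<n , _)) = k<n
    elt<n (inj₂ (_ , k<n , _)) = k<n

  extend-improper⁻¹ : AllImproper (extend M) → AllImproper M
  extend-improper⁻¹ improper i step proper =
    improper (inject₁ i) (Sum.map columnStep-extend columnStep-extend step) (proper-extend proper)

  extend-lastInEven : LastInOdd M → LastInEven (extend M)
  extend-lastInEven (k , r , c , k≡ , k∈ , odd-size) with elt≡⇒≡fromℕ k k≡
  ... | refl = fromℕ (suc m) , r , c , elt-fromℕ (suc m) , from fromℕ∈extend⇔ k∈ ,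
               subst (λ x → x % 2 ≡ 0) (sym (∣entry-extend∣ k∈)) (to (%2≡1⇔1+%2≡0 ∣ entry M r c ∣) odd-size)

  extend-lastInEven⁻¹ : LastInEven (extend M) → LastInOdd M
  extend-lastInEven⁻¹ (k , r , c , k≡ , k∈ , even-size) with elt≡⇒≡fromℕ k k≡
  ... | refl = fromℕ m , r , c , elt-fromℕ m , last∈ ,
               from (%2≡1⇔1+%2≡0 ∣ entry M r c ∣) (subst (λ x → x % 2 ≡ 0) (∣entry-extend∣ last∈) even-size)
    where
    last∈ : fromℕ m ∈ entry M r c
    last∈ = to fromℕ∈extend⇔ k∈

  ⌈colSize/2⌉-extend : IsPartitionMatrix M → AllImproper M → LastInOdd M →
                       ∀ c → ⌈ colSize (extend M) c /2⌉ ≡ ⌈ colSize M c /2⌉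
  ⌈colSize/2⌉-extend isPM improper (k , r₀ , c₀ , k≡ , k∈ , odd-size) c
    with elt≡⇒≡fromℕ k k≡ | c Finₚ.≟ c₀
  ... | refl | no c≢c₀ = cong ⌈_/2⌉ (begin
    colSize (extend M) c                       ≡⟨ colSize-extend c ⟩
    colSize M c + occurrences M c (fromℕ m)    ≡⟨ cong (colSize M c +_)
                                                    (PartitionMatrixProperties.occurrences-∉ isPM k∈ c≢c₀) ⟩
    colSize M c + 0                            ≡⟨ ℕₚ.+-identityʳ _ ⟩
    colSize M c                                ∎)
    where open ≡-Reasoning
  ... | refl | yes refl = begin
    ⌈ colSize (extend M) c /2⌉                     ≡⟨ cong ⌈_/2⌉ (colSize-extend c) ⟩
    ⌈ colSize M c + occurrences M c (fromℕ m) /2⌉  ≡⟨ cong (λ x → ⌈ colSize M c + x /2⌉) (occurrences-∈ k∈) ⟩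
    ⌈ colSize M c + 1 /2⌉                          ≡⟨ cong ⌈_/2⌉ (ℕₚ.+-comm _ 1) ⟩
    ⌈ suc (colSize M c) /2⌉                        ≡⟨ ⌈1+n/2⌉≡⌈n/2⌉ _ (odd-colSize m≡α) ⟩
    ⌈ colSize M c /2⌉                              ∎
    where
    open ≡-Reasoning
    open PartitionMatrixProperties isPM
    open LastColumn isPM improper c (r₀ , k∈)
    m≡α : even (m + toℕ α) ≡ true
    m≡α = trans (sym (odd-∣entry-of-last∣ k∈)) (%2≡bit⇒odd≡ ∣ entry M r₀ c ∣ odd-size)

restrict-extend : ∀ {m D} (M : Matrix (suc m) D) → restrict (extend M) ≡ M
restrict-extend M = matrix-ext λ r c → trans (entry-mapEntries init (extend M) r c)
  (trans (cong init (entry-mapEntries repeatLast M r c)) (Vecₚ.init-∷ʳ _ (entry M r c)))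

-- By the pairing in the last column, an even entry containing n + 1 must also contain n.
lastTwo-sameEntry : ∀ {m D} {Q : Matrix (suc (suc m)) D} → IsPartitionMatrix Q → AllImproper Q → LastInEven Q →
                    ∀ r c → last (init (entry Q r c)) ≡ last (entry Q r c)
lastTwo-sameEntry {m} {Q = Q} isPM improper (k , r₀ , c₀ , k≡ , k∈ , even-size) r c with elt≡⇒≡fromℕ k k≡
... | refl = begin
  last (init (entry Q r c))                   ≡⟨ last-init≡lookup (entry Q r c) ⟩
  lookup (entry Q r c) (inject₁ (fromℕ m))    ≡⟨ lookup≡-sameEntry penultimate∈ k∈ r c ⟩
  lookup (entry Q r c) (fromℕ (suc m))        ≡⟨ last≡lookup-fromℕ (entry Q r c) ⟨
  last (entry Q r c)                          ∎
  where
  open ≡-Reasoning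
  open PartitionMatrixProperties isPM
  open LastColumn isPM improper c₀ (r₀ , k∈)
  1+m≢α : even (suc m + toℕ α) ≡ false
  1+m≢α = trans (sym (odd-∣entry-of-last∣ k∈)) (%2≡bit⇒odd≡ ∣ entry Q r₀ c₀ ∣ even-size)
  m≡α : odd m ≡ odd (toℕ α)
  m≡α = odd-+≡false⇒odd≡odd m (toℕ α)
          (trans (sym (Boolₚ.not-involutive _)) (trans (cong not (sym (odd-suc (m + toℕ α)))) 1+m≢α))
  α≢1+m : toℕ α ≢ suc m
  α≢1+m α≡ with trans (sym (cong not (odd-n+n (suc m)))) (subst (λ a → even (suc m + a) ≡ false) α≡ 1+m≢α)
  ... | ()
  α≤m : toℕ α ≤ m
  α≤m = Data.Nat.s≤s⁻¹ (ℕₚ.≤∧≢⇒< (Finₚ.toℕ≤pred[n] α) α≢1+m)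
  penultimate∈ : inject₁ (fromℕ m) ∈ entry Q r₀ c₀
  penultimate∈ = from ∈⇔lookup≡true (trans
    (paired (trans (Finₚ.toℕ-fromℕ (suc m)) (cong suc (sym (toℕ-inject₁-fromℕ m))))
            (subst (toℕ α ≤_) (sym (toℕ-inject₁-fromℕ m)) α≤m)
            (trans (cong odd (toℕ-inject₁-fromℕ m)) m≡α) r₀)
    (to ∈⇔lookup≡true k∈))

extend-restrict : ∀ {m D} {Q : Matrix (suc (suc m)) D} →
                  .(∀ r c → last (init (entry Q r c)) ≡ last (entry Q r c)) → extend (restrict Q) ≡ Q
extend-restrict {Q = Q} lastTwo = matrix-ext λ r c → begin
  entry (extend (restrict Q)) r c      ≡⟨ entry-mapEntries repeatLast (restrict Q) r c ⟩
  repeatLast (entry (restrict Q) r c)  ≡⟨ cong repeatLast (entry-mapEntries init Q r c) ⟩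
  repeatLast (init (entry Q r c))      ≡⟨ repeatLast-init (entry Q r c) (recompute (Boolₚ._≟_ _ _) (lastTwo r c)) ⟩
  entry Q r c                          ∎
  where open ≡-Reasoning

module _ {m D} {Q : Matrix (suc (suc m)) D}
         (isPM : IsPartitionMatrix Q) (improper : AllImproper Q) (lastEven : LastInEven Q) where

  private
    extend-restrict-Q : extend (restrict Q) ≡ Q
    extend-restrict-Q = extend-restrict (lastTwo-sameEntry isPM improper lastEven)

  restrict-isPM : IsPartitionMatrix (restrict Q)
  restrict-isPM = extend-isPM⁻¹ {M = restrict Q} (subst IsPartitionMatrix (sym extend-restrict-Q) isPM)

  restrict-improper : AllImproper (restrict Q)
  restrict-improper = extend-improper⁻¹ {M = restrict Q} (subst AllImproper (sym extend-restrict-Q) improper)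

  restrict-lastInOdd : LastInOdd (restrict Q)
  restrict-lastInOdd = extend-lastInEven⁻¹ {M = restrict Q} (subst LastInEven (sym extend-restrict-Q) lastEven)

module _ {m : ℕ} where

  φ : IPPM⁻ (suc m) ⤖ IPPM⁺ (suc (suc m))
  φ = ↔⇒⤖ (mk↔ₛ′ forth back forth∘back back∘forth)
    where
    forth : IPPM⁻ (suc m) → IPPM⁺ (suc (suc m))
    forth (ippm⁻ (pm D M isPM) improper lastOdd) =
      ippm⁺ (pm D (extend M) (extend-isPM isPM)) (extend-improper isPM improper) (extend-lastInEven {M = M} lastOdd)
    back : IPPM⁺ (suc (suc m)) → IPPM⁻ (suc m)
    back (ippm⁺ (pm D Q isPM) improper lastEven) =
      ippm⁻ (pm D (restrict Q) (restrict-isPM isPM improper lastEven))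
            (restrict-improper isPM improper lastEven) (restrict-lastInOdd isPM improper lastEven)
    ippm⁺-cong : ∀ {D} {Q Q′ : Matrix (suc (suc m)) D} .{p p′ i i′ l l′} → Q ≡ Q′ →
                 ippm⁺ (pm D Q p) i l ≡ ippm⁺ (pm D Q′ p′) i′ l′
    ippm⁺-cong refl = refl
    ippm⁻-cong : ∀ {D} {M M′ : Matrix (suc m) D} .{p p′ i i′ l l′} → M ≡ M′ →
                 ippm⁻ (pm D M p) i l ≡ ippm⁻ (pm D M′ p′) i′ l′
    ippm⁻-cong refl = refl
    forth∘back : ∀ Q → forth (back Q) ≡ Q
    forth∘back (ippm⁺ (pm D Q isPM) improper lastEven) =
      ippm⁺-cong (extend-restrict (lastTwo-sameEntry isPM improper lastEven))
    back∘forth : ∀ M → back (forth M) ≡ M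
    back∘forth (ippm⁻ (pm D M _) _ _) = ippm⁻-cong (restrict-extend M)

  v-φ : ∀ Q → v (IPPM⁺.pmat (Bijection.to φ Q)) ≡ v (IPPM⁻.pmat Q)
  v-φ (ippm⁻ (pm D M isPM) improper lastOdd) = recompute (ℕₚ._≟_ _ _)
    (cong Data.Vec.sum (Vecₚ.tabulate-cong (⌈colSize/2⌉-extend isPM improper lastOdd)))

lemma5p4 : (n : ℕ) → 1 ≤ n →
    Σ (IPPM⁻ n ⤖ IPPM⁺ (suc n))
      (λ φ → ∀ Q → v (IPPM⁺.pmat (Bijection.to φ Q)) ≡ v (IPPM⁻.pmat Q))
    × Σ (InvSeq⁻ n ⤖ InvSeq⁺ (suc n))
      (λ ψ → ∀ e → dist (InvSeq⁺.seq (Bijection.to ψ e)) ≡ dist (InvSeq⁻.seq e))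
lemma5p4 (suc m) _ = (φ , v-φ) , (ψ , dist-ψ)
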